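{- Let $H$ be the Hilbert system obtained from $\mathbf{C+J}$ by deleting the rule (MPI). Then (MPI) is admissible in $H$: for all formulas $A, B$, if $A$ and $A \to_{\mathtt{i}} B$ are theorems of $H$, then $B$ is a theorem of $H$.
   Context: Formulas are built from a countably infinite set $\mathsf{Prop}$ of propositional variables by the grammar $A ::= p \mid \bot \mid A \lor A \mid A \land A \mid A \to_{\mathtt{i}} A \mid A \to_{\mathtt{c}} A$ ($p \in \mathsf{Prop}$), where $\to_{\mathtt{i}}$ is intuitionistic and $\to_{\mathtt{c}}$ classical implication. Let $\mathsf{Form}_{\mathbf{C}}$ be the formulas not containing $\to_{\mathtt{i}}$. Persistent formulas are given by $E ::= \bot \mid p \mid A \to_{\mathtt{i}} A \mid E \land E \mid E \lor E$ with $p\in\mathsf{Prop}$ and $A$ an arbitrary formula. The Hilbert system $\mathbf{C+J}$ has axioms: (CL) all substitution instances (replacing propositional variables uniformly by arbitrary formulas) of classical tautologies in $\mathsf{Form}_{\mathbf{C}}$ (where $\to_{\mathtt{c}}$ is material implication and $\bot$ is false); (CK) $(A \to_{\mathtt{i}} (B \to_{\mathtt{c}} C)) \to_{\mathtt{c}} ((A \to_{\mathtt{i}} B) \to_{\mathtt{c}} (A \to_{\mathtt{i}} C))$; (ID) $A \to_{\mathtt{i}} A$; (CMP) $(A \to_{\mathtt{i}} B) \to_{\mathtt{c}} (A \to_{\mathtt{c}} B)$; (PER) $A \to_{\mathtt{c}} (B \to_{\mathtt{i}} A)$ for persistent $A$; and rules: (MPI) from $A$ and $A \to_{\mathtt{i}}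 B$ infer $B$; (RCN) from $A$ infer $B \to_{\mathtt{i}} A$; (MPC) from $A$ and $A \to_{\mathtt{c}} B$ infer $B$. Theorems are formulas derivable from the axioms by the rules. -}

module Defs where

open import Data.Nat using (ℕ)
open import Data.Bool using (Bool; true; false; _∧_; _∨_; not)
open import Relation.Binary.PropositionalEquality using (_≡_)

infixr 5 _⇒i_ _⇒c_
infixl 6 _∨'_
infixl 7 _∧'_
data Fm : Set where
  var   : ℕ → Fm
  ⊥'    : Fm
  _∨'_  : Fm → Fm → Fm
  _∧'_  : Fm → Fm → Fm
  _⇒i_  : Fm → Fm → Fm
  _⇒c_  : Fm → Fm → Fm

data InFormC : Fm → Set where
  var : ∀ p → InFormC (var p)
  bot : InFormC ⊥'
  or  : ∀ {A B} → InFormC A → InFormC B → InFormC (A ∨' B)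
  and : ∀ {A B} → InFormC A → InFormC B → InFormC (A ∧' B)
  imp : ∀ {A B} → InFormC A → InFormC B → InFormC (A ⇒c B)

-- Classical (Boolean) evaluation; ⇒c is material implication, ⊥ is false.
-- The ⇒i clause is irrelevant: it is only used on formulas in Form_C.
eval : (ℕ → Bool) → Fm → Bool
eval v (var p)  = v p
eval v ⊥'       = false
eval v (A ∨' B) = eval v A ∨ eval v B
eval v (A ∧' B) = eval v A ∧ eval v B
eval v (A ⇒i B) = false
eval v (A ⇒c B) = not (eval v A) ∨ eval v B

record Tautology (A : Fm) : Set where
  field
    formC : InFormC A
    valid : ∀ (v : ℕ → Bool) → eval v A ≡ true

subst : (ℕ → Fm) → Fm → Fm
subst σ (var p)  = σ p
subst σ ⊥'       = ⊥'
subst σ (A ∨' B) = subst σ A ∨' subst σ B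
subst σ (A ∧' B) = subst σ A ∧' subst σ B
subst σ (A ⇒i B) = subst σ A ⇒i subst σ B
subst σ (A ⇒c B) = subst σ A ⇒c subst σ B

data Persistent : Fm → Set where
  bot : Persistent ⊥'
  var : ∀ p → Persistent (var p)
  imp : ∀ A B → Persistent (A ⇒i B)
  and : ∀ {E F} → Persistent E → Persistent F → Persistent (E ∧' F)
  or  : ∀ {E F} → Persistent E → Persistent F → Persistent (E ∨' F)

-- Theorems of H = C+J without the rule (MPI)
data ThmH : Fm → Set where
  CL  : ∀ (A : Fm) (σ : ℕ → Fm) → Tautology A → ThmH (subst σ A)
  CK  : ∀ A B C → ThmH ((A ⇒i (B ⇒c C)) ⇒c ((A ⇒i B) ⇒c (A ⇒i C)))
  ID  : ∀ A → ThmH (A ⇒i A)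
  CMP : ∀ A B → ThmH ((A ⇒i B) ⇒c (A ⇒c B))
  PER : ∀ A B → Persistent A → ThmH (A ⇒c (B ⇒i A))
  RCN : ∀ {A} B → ThmH A → ThmH (B ⇒i A)
  MPC : ∀ {A B} → ThmH A → ThmH (A ⇒c B) → ThmH B

{-# OPTIONS --safe #-}
module Submission where

open import Defs

⇒i-to-⇒c : ∀ {A B} → ThmH (A ⇒i B) → ThmH (A ⇒c B)
⇒i-to-⇒c {A} {B} ⊢A⇒iB = MPC ⊢A⇒iB (CMP A B)

proposition4 : ∀ (A B : Fm) → ThmH A → ThmH (A ⇒i B) → ThmH B
proposition4 A B ⊢A ⊢A⇒iB = MPC ⊢A (⇒i-to-⇒c ⊢A⇒iB)
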